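{- Let $G$ be a graph with minimum degree $\delta(G)=1$, and let $S_1$ be the set of vertices of degree $1$ in $G$. Then $G$ has a $2$-partition $(V_1,V_2)$ such that every vertex of $V_1$ has at least one neighbour in $V_2$ and every vertex of $V_2$ has at least two neighbours in $V_1$ if and only if $S_1$ is a stable set and every vertex of $N(S_1)$ has either two neighbours in $S_1$ or at least one neighbour in $V(G)\setminus (S_1\cup N(S_1))$.
   Context: A $2$-partition of $G$ is a partition $(V_1,V_2)$ of $V(G)$. $N(S_1)$ denotes the set of vertices adjacent to some vertex of $S_1$. -}

module Defs where

open import Data.Nat using (ℕ; _≥_)
open import Data.Fin using (Fin)
open import Data.List using (List; length; filter; allFin)
open import Data.Bool using (Bool; true; false)
open import Data.Product using (Σ; ∃; _×_; _,_)
open import Relation.Nullary using (¬_; Dec)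
open import Relation.Binary.PropositionalEquality using (_≡_; _≢_)
open import Data.Sum using (_⊎_)

record Graph (n : ℕ) : Set₁ where
  field
    Adj    : Fin n → Fin n → Set
    adj?   : ∀ u v → Dec (Adj u v)
    sym    : ∀ {u v} → Adj u v → Adj v u
    irrefl : ∀ {u} → ¬ Adj u u

module _ {n : ℕ} (G : Graph n) where
  open Graph G

  degree : Fin n → ℕ
  degree v = length (filter (adj? v) (allFin n))

  MinDegree : ℕ → Set
  MinDegree k = (∃ λ v → degree v ≡ k) × (∀ v → degree v ≥ k)

  InS₁ : Fin n → Set
  InS₁ v = degree v ≡ 1

  InNS₁ : Fin n → Set
  InNS₁ v = ∃ λ u → InS₁ u × Adj v u

  S₁Stable : Set
  S₁Stable = ∀ u v → InS₁ u → InS₁ v → ¬ Adj u v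

  NS₁Condition : Set
  NS₁Condition = ∀ v → InNS₁ v →
      (Σ (Fin n) λ a → Σ (Fin n) λ b →
         a ≢ b × Adj v a × Adj v b × InS₁ a × InS₁ b)
    ⊎ (∃ λ w → Adj v w × ¬ InS₁ w × ¬ InNS₁ w)

  -- A 2-partition (V₁,V₂) is given by p : Fin n → Bool, V₁ = p⁻¹ true, V₂ = p⁻¹ false.
  GoodPartition : (Fin n → Bool) → Set
  GoodPartition p =
      (∀ v → p v ≡ true → ∃ λ u → Adj v u × p u ≡ false)
    × (∀ v → p v ≡ false → Σ (Fin n) λ a → Σ (Fin n) λ b →
         a ≢ b × Adj v a × Adj v b × p a ≡ true × p b ≡ true)

module Submission where

-- Necessity.  A leaf cannot lie in V₂ (it lacks two neighbours), so S₁ ⊆ V₁;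
-- its unique neighbour must then lie in V₂, so N(S₁) ⊆ V₂.  Hence S₁ is stable,
-- and the two V₁-neighbours of a vertex of N(S₁) are either both leaves or one
-- of them lies in V₁ \ S₁, i.e. outside S₁ ∪ N(S₁).
--
-- Sufficiency.  Call a vertex free if it lies outside S₁ ∪ N(S₁) and has no
-- neighbour in N(S₁).  Let I be a maximal independent set of free vertices
-- (built greedily) and put V₂ = N(S₁) ∪ I.  Leaves are dominated by N(S₁),
-- non-free vertices of V₁ by N(S₁), free ones by I (maximality); a vertex of
-- I has degree ≥ 2 and all its neighbours lie in V₁ (freeness, independence);
-- a vertex of N(S₁) gets its two V₁-neighbours from the hypothesis.

open import Defs
open import Data.Nat using (ℕ; _≤_; _≥_; s≤s)
open import Data.Nat.Properties using (_≟_; ≤∧≢⇒<)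
open import Data.Fin using (Fin)
open import Data.Fin.Properties using (any?; all?) renaming (_≟_ to _≟ᶠ_)
open import Data.Bool using (Bool; true; false)
open import Data.Product using (Σ; ∃; _×_; _,_; proj₁; proj₂)
open import Data.Sum using (_⊎_; inj₁; inj₂; [_,_])
open import Data.Empty using (⊥; ⊥-elim)
open import Data.List using (List; []; _∷_; length; filter; allFin)
open import Data.List.Membership.Propositional using (_∈_; _∉_; find; lose)
open import Data.List.Membership.Propositional.Properties using (∈-allFin; ∈-filter⁺; ∈-filter⁻)
open import Data.List.Relation.Unary.Any as Any using (here; there)
open import Data.List.Relation.Unary.All as All using ()
open import Data.List.Relation.Unary.AllPairs using (_∷_)
open import Data.List.Relation.Unary.Unique.Propositional using (Unique)
open import Data.List.Relation.Unary.Unique.Propositional.Properties using (allFin⁺; filter⁺)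
open import Level using (Level; 0ℓ)
open import Relation.Nullary using (¬_; Dec; yes; no)
open import Relation.Nullary.Decidable using (_×-dec_; _⊎-dec_; _→-dec_; ¬?; isNo; decidable-stable)
open import Relation.Unary using (Pred; Decidable)
open import Relation.Binary.PropositionalEquality using (_≡_; _≢_; refl; sym; subst)
open import Function.Bundles using (_⇔_; mk⇔)

private
  variable
    a ℓ : Level
    A : Set a

true-and-false : ∀ {b : Bool} → b ≡ true → b ≡ false → ⊥
true-and-false refl ()

isNo-yes : (d : Dec A) → A → isNo d ≡ false
isNo-yes (yes _) _ = refl
isNo-yes (no ¬x) x = ⊥-elim (¬x x)

isNo-no : (d : Dec A) → ¬ A → isNo d ≡ true
isNo-no (yes x) ¬x = ⊥-elim (¬x x)
isNo-no (no _) _ = refl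

isNo≡true⇒¬ : (d : Dec A) → isNo d ≡ true → ¬ A
isNo≡true⇒¬ (no ¬x) _ = ¬x

isNo≡false⇒holds : (d : Dec A) → isNo d ≡ false → A
isNo≡false⇒holds (yes x) _ = x

nonempty-member : {xs : List A} → 1 ≤ length xs → ∃ λ x → x ∈ xs
nonempty-member {xs = x ∷ _} _ = x , here refl

singleton-members : {xs : List A} {x y : A} →
  length xs ≡ 1 → x ∈ xs → y ∈ xs → x ≡ y
singleton-members {xs = _ ∷ []} _ (here refl) (here refl) = refl

two-distinct-members : {xs : List A} → Unique xs → 2 ≤ length xs →
  Σ A λ x → Σ A λ y → x ≢ y × x ∈ xs × y ∈ xs
two-distinct-members {xs = x ∷ y ∷ _} (x∉ ∷ _) _ =
  x , y , All.head x∉ , here refl , there (here refl)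
two-distinct-members {xs = _ ∷ []} _ (s≤s ())

module Neighbourhood {n : ℕ} (G : Graph n) where
  open Graph G renaming (sym to adj-sym)

  neighbours : Fin n → List (Fin n)
  neighbours v = filter (adj? v) (allFin n)

  adjacent⇒neighbour : ∀ {v u} → Adj v u → u ∈ neighbours v
  adjacent⇒neighbour {v} {u} vu = ∈-filter⁺ (adj? v) (∈-allFin u) vu

  neighbour⇒adjacent : ∀ {v u} → u ∈ neighbours v → Adj v u
  neighbour⇒adjacent {v} u∈ = proj₂ (∈-filter⁻ (adj? v) {xs = allFin n} u∈)

  positive-degree⇒neighbour : ∀ {v} → 1 ≤ degree G v → ∃ λ u → Adj v u
  positive-degree⇒neighbour d with nonempty-member d
  ... | u , u∈ = u , neighbour⇒adjacent u∈

  leaf-neighbour-unique : ∀ {v a b} → degree G v ≡ 1 → Adj v a → Adj v b → a ≡ b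
  leaf-neighbour-unique d va vb =
    singleton-members d (adjacent⇒neighbour va) (adjacent⇒neighbour vb)

  two-neighbours : ∀ {v} → 2 ≤ degree G v →
    Σ (Fin n) λ a → Σ (Fin n) λ b → a ≢ b × Adj v a × Adj v b
  two-neighbours {v} d
    with two-distinct-members (filter⁺ (adj? v) (allFin⁺ n)) d
  ... | a , b , a≢b , a∈ , b∈ = a , b , a≢b , neighbour⇒adjacent a∈ , neighbour⇒adjacent b∈

module GreedyIndependentSet {n : ℕ} (G : Graph n)
    {C : Pred (Fin n) ℓ} (C? : Decidable C) where
  open Graph G renaming (sym to adj-sym)

  greedy : List (Fin n) → List (Fin n)
  greedy [] = []
  greedy (x ∷ xs) with C? x ×-dec ¬? (Any.any? (adj? x) (greedy xs))
  ... | yes _ = x ∷ greedy xs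
  ... | no _ = greedy xs

  greedy-candidates : ∀ xs {v} → v ∈ greedy xs → C v
  greedy-candidates (x ∷ xs) v∈ with C? x ×-dec ¬? (Any.any? (adj? x) (greedy xs))
  greedy-candidates (x ∷ xs) (here refl) | yes (cx , _) = cx
  greedy-candidates (x ∷ xs) (there v∈) | yes _ = greedy-candidates xs v∈
  greedy-candidates (x ∷ xs) v∈ | no _ = greedy-candidates xs v∈

  greedy-independent : ∀ xs {u v} → u ∈ greedy xs → v ∈ greedy xs → ¬ Adj u v
  greedy-independent (x ∷ xs) u∈ v∈ with C? x ×-dec ¬? (Any.any? (adj? x) (greedy xs))
  greedy-independent (x ∷ xs) u∈ v∈ | no _ = greedy-independent xs u∈ v∈
  greedy-independent (x ∷ xs) (here refl) (here refl) | yes _ = irrefl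
  greedy-independent (x ∷ xs) (here refl) (there v∈) | yes (_ , isolated) =
    λ xv → isolated (lose v∈ xv)
  greedy-independent (x ∷ xs) (there u∈) (here refl) | yes (_ , isolated) =
    λ ux → isolated (lose u∈ (adj-sym ux))
  greedy-independent (x ∷ xs) (there u∈) (there v∈) | yes _ =
    greedy-independent xs u∈ v∈

  greedy-dominating : ∀ xs {v} → v ∈ xs → C v → v ∉ greedy xs →
    ∃ λ u → u ∈ greedy xs × Adj v u
  greedy-dominating (x ∷ xs) v∈ cv v∉ with C? x ×-dec ¬? (Any.any? (adj? x) (greedy xs))
  greedy-dominating (x ∷ xs) (here refl) cv v∉ | yes _ = ⊥-elim (v∉ (here refl))
  greedy-dominating (x ∷ xs) (here refl) cv v∉ | no rejected =
    find (decidable-stable (Any.any? (adj? x) (greedy xs)) (λ isolated → rejected (cv , isolated)))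
  greedy-dominating (x ∷ xs) (there v∈) cv v∉ | yes _
    with greedy-dominating xs v∈ cv (λ v∈′ → v∉ (there v∈′))
  ... | u , u∈ , vu = u , there u∈ , vu
  greedy-dominating (x ∷ xs) (there v∈) cv v∉ | no _ = greedy-dominating xs v∈ cv v∉

module PartitionFromPredicate {n : ℕ} (G : Graph n) where
  open Graph G renaming (sym to adj-sym)

  GoodSecondPart : Pred (Fin n) ℓ → Set ℓ
  GoodSecondPart V₂ =
      (∀ v → ¬ V₂ v → ∃ λ u → Adj v u × V₂ u)
    × (∀ v → V₂ v → Σ (Fin n) λ a → Σ (Fin n) λ b →
         a ≢ b × Adj v a × Adj v b × ¬ V₂ a × ¬ V₂ b)

  goodPartition : {V₂ : Pred (Fin n) ℓ} (V₂? : Decidable V₂) →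
    GoodSecondPart V₂ → GoodPartition G (λ v → isNo (V₂? v))
  goodPartition {V₂ = V₂} V₂? (dominated , doubly) = V₁-condition , V₂-condition
    where
      V₁-condition : ∀ v → isNo (V₂? v) ≡ true → ∃ λ u → Adj v u × isNo (V₂? u) ≡ false
      V₁-condition v pv with dominated v (isNo≡true⇒¬ (V₂? v) pv)
      ... | u , vu , u∈V₂ = u , vu , isNo-yes (V₂? u) u∈V₂

      V₂-condition : ∀ v → isNo (V₂? v) ≡ false → Σ (Fin n) λ a → Σ (Fin n) λ b →
        a ≢ b × Adj v a × Adj v b × isNo (V₂? a) ≡ true × isNo (V₂? b) ≡ true
      V₂-condition v pv with doubly v (isNo≡false⇒holds (V₂? v) pv)
      ... | a , b , a≢b , va , vb , a∉ , b∉ =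
        a , b , a≢b , va , vb , isNo-no (V₂? a) a∉ , isNo-no (V₂? b) b∉

module Necessity {n : ℕ} (G : Graph n) (p : Fin n → Bool) (good : GoodPartition G p) where
  open Graph G renaming (sym to adj-sym)
  open Neighbourhood G

  leaf-in-V₁ : ∀ {u} → InS₁ G u → p u ≡ true
  leaf-in-V₁ {u} leaf with p u in pu
  ... | true = refl
  ... | false with proj₂ good u pu
  ... | a , b , a≢b , ua , ub , _ = ⊥-elim (a≢b (leaf-neighbour-unique leaf ua ub))

  leaf-neighbour-in-V₂ : ∀ {u v} → InS₁ G u → Adj u v → p v ≡ false
  leaf-neighbour-in-V₂ {u} leaf uv with proj₁ good u (leaf-in-V₁ leaf)
  ... | w , uw , pw = subst (λ z → p z ≡ false) (leaf-neighbour-unique leaf uw uv) pw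

  NS₁-in-V₂ : ∀ {v} → InNS₁ G v → p v ≡ false
  NS₁-in-V₂ (u , leaf , vu) = leaf-neighbour-in-V₂ leaf (adj-sym vu)

  stable : S₁Stable G
  stable u v leaf-u leaf-v uv =
    true-and-false (leaf-in-V₁ leaf-v) (leaf-neighbour-in-V₂ leaf-u uv)

  -- A V₁-neighbour w of a vertex of N(S₁) is not in N(S₁), since N(S₁) ⊆ V₂.
  condition : NS₁Condition G
  condition v ns with proj₂ good v (NS₁-in-V₂ ns)
  ... | a , b , a≢b , va , vb , pa , pb with degree G a ≟ 1 | degree G b ≟ 1
  ... | yes leaf-a | yes leaf-b = inj₁ (a , b , a≢b , va , vb , leaf-a , leaf-b)
  ... | no ¬leaf-a | _ = inj₂ (a , va , ¬leaf-a , λ ns-a → true-and-false pa (NS₁-in-V₂ ns-a))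
  ... | yes _ | no ¬leaf-b = inj₂ (b , vb , ¬leaf-b , λ ns-b → true-and-false pb (NS₁-in-V₂ ns-b))

module Sufficiency {n : ℕ} (G : Graph n)
    (stable : S₁Stable G) (condition : NS₁Condition G)
    (min-degree : ∀ v → degree G v ≥ 1) where
  open Graph G renaming (sym to adj-sym)
  open Neighbourhood G
  open PartitionFromPredicate G

  S₁? : Decidable (InS₁ G)
  S₁? v = degree G v ≟ 1

  NS₁? : Decidable (InNS₁ G)
  NS₁? v = any? (λ u → S₁? u ×-dec adj? v u)

  Free : Pred (Fin n) 0ℓ
  Free v = ¬ InS₁ G v × ¬ InNS₁ G v × (∀ u → Adj v u → ¬ InNS₁ G u)

  Free? : Decidable Free
  Free? v = ¬? (S₁? v) ×-dec ¬? (NS₁? v) ×-dec all? (λ u → adj? v u →-dec ¬? (NS₁? u))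

  open GreedyIndependentSet G Free?
  open import Data.List.Membership.DecPropositional (_≟ᶠ_ {n}) using (_∈?_)

  I : List (Fin n)
  I = greedy (allFin n)

  V₂ : Pred (Fin n) 0ℓ
  V₂ v = InNS₁ G v ⊎ v ∈ I

  V₂? : Decidable V₂
  V₂? v = NS₁? v ⊎-dec (v ∈? I)

  leaf-outside-V₂ : ∀ {a} → InS₁ G a → ¬ V₂ a
  leaf-outside-V₂ leaf (inj₁ (u , leaf-u , au)) = stable _ u leaf leaf-u au
  leaf-outside-V₂ leaf (inj₂ a∈I) = proj₁ (greedy-candidates (allFin n) a∈I) leaf

  -- A neighbour of a vertex in N(S₁) is never free, hence not in I.
  NS₁-neighbour-outside-I : ∀ {v w} → InNS₁ G v → Adj v w → w ∉ I
  NS₁-neighbour-outside-I ns vw w∈I =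
    proj₂ (proj₂ (greedy-candidates (allFin n) w∈I)) _ (adj-sym vw) ns

  -- Leaves see N(S₁); other V₁-vertices see N(S₁) or are free and, being
  -- outside I, see I by maximality.
  dominated : ∀ v → ¬ V₂ v → ∃ λ u → Adj v u × V₂ u
  dominated v v∉V₂ with S₁? v | any? (λ u → adj? v u ×-dec NS₁? u)
  ... | yes leaf | _ with positive-degree⇒neighbour (min-degree v)
  ...   | u , vu = u , vu , inj₁ (v , leaf , adj-sym vu)
  dominated v v∉V₂ | no _ | yes (u , vu , ns) = u , vu , inj₁ ns
  dominated v v∉V₂ | no ¬leaf | no no-NS₁-neighbour
    with greedy-dominating (allFin n) (∈-allFin v)
           (¬leaf , (λ ns → v∉V₂ (inj₁ ns)) , λ u vu ns → no-NS₁-neighbour (u , vu , ns))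
           (λ v∈I → v∉V₂ (inj₂ v∈I))
  ... | u , u∈I , vu = u , vu , inj₂ u∈I

  -- A vertex of N(S₁) uses the hypothesis; a vertex of I has degree ≥ 2 and
  -- none of its neighbours is in N(S₁) (freeness) or in I (independence).
  doubly-dominated : ∀ v → V₂ v → Σ (Fin n) λ a → Σ (Fin n) λ b →
    a ≢ b × Adj v a × Adj v b × ¬ V₂ a × ¬ V₂ b
  doubly-dominated v (inj₁ ns) with condition v ns
  ... | inj₁ (a , b , a≢b , va , vb , leaf-a , leaf-b) =
    a , b , a≢b , va , vb , leaf-outside-V₂ leaf-a , leaf-outside-V₂ leaf-b
  ... | inj₂ (w , vw , ¬leaf-w , ¬ns-w) with ns
  ...   | u , leaf-u , vu =
    u , w , (λ u≡w → ¬leaf-w (subst (InS₁ G) u≡w leaf-u)) , vu , vw ,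
    leaf-outside-V₂ leaf-u , [ ¬ns-w , NS₁-neighbour-outside-I ns vw ]
  doubly-dominated v (inj₂ v∈I) with greedy-candidates (allFin n) v∈I
  ... | ¬leaf , _ , no-NS₁-neighbour
    with two-neighbours (≤∧≢⇒< (min-degree v) (λ d≡1 → ¬leaf (sym d≡1)))
  ... | a , b , a≢b , va , vb = a , b , a≢b , va , vb , outside va , outside vb
    where
      outside : ∀ {x} → Adj v x → ¬ V₂ x
      outside vx (inj₁ ns) = no-NS₁-neighbour _ vx ns
      outside vx (inj₂ x∈I) = greedy-independent (allFin n) v∈I x∈I vx

  partition : ∃ λ (p : Fin n → Bool) → GoodPartition G p
  partition = (λ v → isNo (V₂? v)) , goodPartition V₂? (dominated , doubly-dominated)

theorem3p3 : (n : ℕ) (G : Graph n) → MinDegree G 1 →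
    (∃ λ (p : Fin n → Bool) → GoodPartition G p) ⇔ (S₁Stable G × NS₁Condition G)
theorem3p3 n G (_ , min-degree) = mk⇔
  (λ (p , good) → Necessity.stable G p good , Necessity.condition G p good)
  (λ (stable , condition) → Sufficiency.partition G stable condition min-degree)
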